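{- Let $F\colon\mathbb{B}^{2L}\to\mathbb{B}^{2L}$ be the Boolean Delta-Notch system over a graph $\mathcal{G}$ as in the context, let $x\in\mathbb{B}^{2L}$ be a fixed point of $F$ and let $i\in C$. (i) If $x_i=0$, then there exists a trap space for $F$ of the form $x[I\cup(I+L)]$ with $\{i\}\subseteq I\subseteq\{i\}\cup S(i)$. (ii) If $x_i=1$, then there exists a trap space for $F$ of the form $x[I\cup(I+L)]$ with $\{i\}\subseteq I\subseteq\{i\}\cup S(i)\cup S(S(i))$.
   Context: Let $L\ge 1$ and let $\mathcal{G}$ be an undirected connected graph without loops on the vertex set $C=\{1,\dots,L\}$. For $i\in C$ let $S(i)$ be the set of neighbours of $i$ in $\mathcal{G}$, and for $A\subseteq C$ let $S(A)=\bigcup_{j\in A}S(j)$; $A+L=\{j+L: j\in A\}$. $\mathbb{B}=\{0,1\}$. States of $\mathbb{B}^{2L}$ are written $x=(n,d)=(n_1,\dots,n_L,d_1,\dots,d_L)$, so $x_i=n_i$. The Boolean Delta-Notch system is $F\colon\mathbb{B}^{2L}\to\mathbb{B}^{2L}$ with $F_i(n,d)=\bigvee_{j\in S(i)}d_j$ (empty disjunction $=0$) and $F_{i+L}(n,d)=1-n_i$. $AD_F$ has an edge from $y$ to the state obtained by flipping coordinate $j$ whenever $F_j(y)\neq y_j$. The subspace $x[I]$ is $\{y: y_j=x_j\ \forall j\notin I\}$; a trap space is a subspace such that every successor in $AD_F$ of its states lies in it. -}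

module Defs where

open import Data.Nat using (ℕ)
open import Data.Bool using (Bool; true; false; _∧_; _∨_; not; if_then_else_)
open import Data.Fin using (Fin)
open import Data.Fin.Properties using (_≟_)
open import Data.List using (List; []; _∷_; map; allFin)
open import Data.Bool.ListAction using (or)
open import Data.Sum using (_⊎_; inj₁; inj₂)
open import Data.Product using (Σ; ∃; _×_; _,_)
open import Relation.Nullary using (¬_; does)
open import Relation.Binary.PropositionalEquality using (_≡_)

-- An undirected loopless graph on the vertex set C = Fin L (vertex i+1 of the
-- paper is Fin element i), given by a Boolean adjacency relation.
record Graph (L : ℕ) : Set where
  field
    adj       : Fin L → Fin L → Bool
    symmetric : ∀ i j → adj i j ≡ adj j i
    loopless  : ∀ i → adj i i ≡ false

open Graph public

data Reach {L : ℕ} (G : Graph L) : Fin L → Fin L → Set where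
  here : ∀ {i} → Reach G i i
  step : ∀ {i j k} → adj G i j ≡ true → Reach G j k → Reach G i k

Connected : {L : ℕ} → Graph L → Set
Connected G = ∀ i j → Reach G i j

-- Coordinates of 𝔹^{2L}: inj₁ i is coordinate i (n_i), inj₂ i is coordinate i+L (d_i).
Coord : ℕ → Set
Coord L = Fin L ⊎ Fin L

State : ℕ → Set
State L = Coord L → Bool

deltaNotch : {L : ℕ} → Graph L → State L → State L
deltaNotch {L} G x (inj₁ i) = or (map (λ j → adj G i j ∧ x (inj₂ j)) (allFin L))
deltaNotch G x (inj₂ i) = not (x (inj₁ i))

IsFixedPoint : {L : ℕ} → Graph L → State L → Set
IsFixedPoint G x = ∀ c → deltaNotch G x c ≡ x c

decCoord : {L : ℕ} → (a b : Coord L) → Bool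
decCoord (inj₁ i) (inj₁ j) = does (i ≟ j)
decCoord (inj₂ i) (inj₂ j) = does (i ≟ j)
decCoord _ _ = false

flipAt : {L : ℕ} → Coord L → State L → State L
flipAt c y c' = if decCoord c c' then not (y c') else y c'

ADEdge : {L : ℕ} → (State L → State L) → State L → State L → Set
ADEdge {L} F y z = Σ (Coord L) λ c → (¬ (F y c ≡ y c)) × (z ≡ flipAt c y)

CoordSet : ℕ → Set
CoordSet L = Coord L → Bool

InSubspace : {L : ℕ} → State L → CoordSet L → State L → Set
InSubspace x J y = ∀ c → J c ≡ false → y c ≡ x c

IsTrapSpace : {L : ℕ} → (State L → State L) → State L → CoordSet L → Set
IsTrapSpace F x J = ∀ y z → InSubspace x J y → ADEdge F y z → InSubspace x J z

VSet : ℕ → Set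
VSet L = Fin L → Bool

doubled : {L : ℕ} → VSet L → CoordSet L
doubled I (inj₁ i) = I i
doubled I (inj₂ i) = I i

_⊆_ : {L : ℕ} → VSet L → VSet L → Set
A ⊆ B = ∀ j → A j ≡ true → B j ≡ true

singleton : {L : ℕ} → Fin L → VSet L
singleton i j = does (i ≟ j)

closedNbhd : {L : ℕ} → Graph L → Fin L → VSet L
closedNbhd G i j = does (i ≟ j) ∨ adj G i j

secondNbhd : {L : ℕ} → Graph L → Fin L → VSet L
secondNbhd {L} G i j = or (map (λ k → adj G i k ∧ adj G k j) (allFin L))

closedNbhd2 : {L : ℕ} → Graph L → Fin L → VSet L
closedNbhd2 G i j = closedNbhd G i j ∨ secondNbhd G i j

-- At a fixed point x the vertices with d = 1 form a maximal independent set D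
-- (n_k = 0 exactly when k ∈ D, and every k ∉ D has a neighbour in D). Choose a
-- set W ⊆ D containing i or the D-neighbours of i, and let I be W together with
-- the vertices outside D all of whose D-neighbours lie in W. For k ∉ I the
-- Notch input ⋁_{j ∈ S(k)} d_j is then frozen on x[I ∪ (I + L)]: if k ∈ D none of
-- its neighbours lies in I, and if k ∉ D it has a D-neighbour outside W, hence
-- outside I, whose d stays 1. Frozen inputs for every coordinate outside the
-- subspace make it a trap space, and I lies in the required neighbourhood of i
-- because every vertex of I ∖ W has a neighbour in W.
module Submission where

open import Defs
open import Data.Nat using (ℕ; _≥_)
open import Data.Bool using (Bool; true; false; _∧_; _∨_; not)
open import Data.Bool.Properties using (T-≡; ∧-conicalˡ; ∧-conicalʳ; ∨-conicalˡ; ∨-conicalʳ; ∧-zeroʳ)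
open import Data.Bool.ListAction using (or)
open import Data.Empty using (⊥-elim)
open import Data.Fin using (Fin)
open import Data.Fin.Properties using (_≟_)
open import Data.List using ([]; _∷_; map; allFin)
open import Data.List.Properties using (map-cong)
open import Data.List.Membership.Propositional using (lose)
open import Data.List.Membership.Propositional.Properties using (∈-allFin)
open import Data.List.Relation.Unary.Any using (satisfied)
open import Data.List.Relation.Unary.Any.Properties using (any⁺; any⁻)
open import Data.Product using (Σ; ∃-syntax; _×_; _,_)
open import Data.Sum using (_⊎_; inj₁; inj₂)
open import Function.Base using (_∘_)
open import Function.Bundles using (Equivalence)
open import Relation.Nullary using (does; yes)
open import Relation.Binary.PropositionalEquality using (_≡_; refl; sym; trans; cong)

open Equivalence using (to; from)

∧-true⁺ : ∀ {a b} → a ≡ true → b ≡ true → a ∧ b ≡ true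
∧-true⁺ refl refl = refl

∨-false⁺ : ∀ {a b} → a ≡ false → b ≡ false → a ∨ b ≡ false
∨-false⁺ refl refl = refl

not-true⁻ : ∀ {a} → not a ≡ true → a ≡ false
not-true⁻ {false} _ = refl

not-false⁻ : ∀ {a} → not a ≡ false → a ≡ true
not-false⁻ {true} _ = refl

_∪_ : ∀ {L} → VSet L → VSet L → VSet L
(A ∪ B) j = A j ∨ B j

_∩_ : ∀ {L} → VSet L → VSet L → VSet L
(A ∩ B) j = A j ∧ B j

⊆-trans : ∀ {L} {A B C : VSet L} → A ⊆ B → B ⊆ C → A ⊆ C
⊆-trans A⊆B B⊆C j = B⊆C j ∘ A⊆B j

∪-introˡ : ∀ {L} {A B : VSet L} → A ⊆ (A ∪ B)
∪-introˡ {A = A} j Aj rewrite Aj = refl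

∪-introʳ : ∀ {L} {A B : VSet L} → B ⊆ (A ∪ B)
∪-introʳ {A = A} j Bj with A j
... | true = refl
... | false = Bj

∪-least : ∀ {L} {A B C : VSet L} → A ⊆ C → B ⊆ C → (A ∪ B) ⊆ C
∪-least {A = A} A⊆C B⊆C j ABj with A j in Aj
... | true = A⊆C j Aj
... | false = B⊆C j ABj

or-allFin⁺ : ∀ {n} (f : Fin n → Bool) m → f m ≡ true → or (map f (allFin n)) ≡ true
or-allFin⁺ f m fm = to T-≡ (any⁺ f (lose (∈-allFin m) (from T-≡ fm)))

or-allFin⁻ : ∀ {n} (f : Fin n → Bool) → or (map f (allFin n)) ≡ true → ∃[ m ] f m ≡ true
or-allFin⁻ {n} f any-f with satisfied (any⁻ f (allFin n) (from T-≡ any-f))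
... | m , fm = m , to T-≡ fm

or-false : ∀ {A : Set} (f : A → Bool) xs → (∀ a → f a ≡ false) → or (map f xs) ≡ false
or-false f [] _ = refl
or-false f (a ∷ xs) none rewrite none a = or-false f xs none

does-≟-sound : ∀ {n} {i j : Fin n} → does (i ≟ j) ≡ true → i ≡ j
does-≟-sound {i = i} {j} eq with i ≟ j
... | yes i≡j = i≡j

decCoord-sound : ∀ {L} {a b : Coord L} → decCoord a b ≡ true → a ≡ b
decCoord-sound {a = inj₁ i} {inj₁ j} eq = cong inj₁ (does-≟-sound eq)
decCoord-sound {a = inj₂ i} {inj₂ j} eq = cong inj₂ (does-≟-sound eq)

frozen⇒trapSpace : ∀ {L} (F : State L → State L) (x : State L) (J : CoordSet L) →
  (∀ y → InSubspace x J y → ∀ c → J c ≡ false → F y c ≡ x c) →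
  IsTrapSpace F x J
frozen⇒trapSpace F x J frozen y _ y∈ (c′ , moves , refl) c c∉J with decCoord c′ c in eq
... | false = y∈ c c∉J
... | true with decCoord-sound {a = c′} {c} eq
...   | refl = ⊥-elim (moves (trans (frozen y y∈ c c∉J) (sym (y∈ c c∉J))))

module FixedPoint {L : ℕ} (G : Graph L) (x : State L) (fp : IsFixedPoint G x) where

  notch : Fin L → Bool
  notch k = x (inj₁ k)

  delta : Fin L → Bool
  delta k = x (inj₂ k)

  delta≡not-notch : ∀ k → delta k ≡ not (notch k)
  delta≡not-notch k = sym (fp (inj₂ k))

  notch-false⇒delta : ∀ {k} → notch k ≡ false → delta k ≡ true
  notch-false⇒delta {k} nk = trans (delta≡not-notch k) (cong not nk)

  delta-true⇒notch : ∀ {k} → delta k ≡ true → notch k ≡ false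
  delta-true⇒notch {k} dk = not-true⁻ (trans (sym (delta≡not-notch k)) dk)

  delta-false⇒notch : ∀ {k} → delta k ≡ false → notch k ≡ true
  delta-false⇒notch {k} dk = not-false⁻ (trans (sym (delta≡not-notch k)) dk)

  notch-true⇒delta-neighbour : ∀ {k} → notch k ≡ true → ∃[ m ] adj G k m ≡ true × delta m ≡ true
  notch-true⇒delta-neighbour {k} nk
    with or-allFin⁻ (λ m → adj G k m ∧ delta m) (trans (fp (inj₁ k)) nk)
  ... | m , km = m , ∧-conicalˡ _ _ km , ∧-conicalʳ _ _ km

  delta-neighbour⇒notch : ∀ {k m} → adj G k m ≡ true → delta m ≡ true → notch k ≡ true
  delta-neighbour⇒notch {k} {m} km dm =
    trans (sym (fp (inj₁ k))) (or-allFin⁺ (λ m → adj G k m ∧ delta m) m (∧-true⁺ km dm))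

  Shielded : VSet L → Set
  Shielded I = ∀ k → I k ≡ false →
    (∀ m → adj G k m ≡ true → I m ≡ false) ⊎
    (∃[ m ] adj G k m ≡ true × I m ≡ false × delta m ≡ true)

  shielded⇒frozen : ∀ I → Shielded I → ∀ y → InSubspace x (doubled I) y →
    ∀ c → doubled I c ≡ false → deltaNotch G y c ≡ x c
  shielded⇒frozen I shielded y y∈ (inj₂ k) k∉I = trans (cong not (y∈ (inj₁ k) k∉I)) (fp (inj₂ k))
  shielded⇒frozen I shielded y y∈ (inj₁ k) k∉I with shielded k k∉I
  ... | inj₁ isolated = trans (cong or (map-cong agree (allFin L))) (fp (inj₁ k))
    where
    agree : ∀ m → (adj G k m ∧ y (inj₂ m)) ≡ (adj G k m ∧ delta m)
    agree m with adj G k m in km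
    ... | true = y∈ (inj₂ m) (isolated m km)
    ... | false = refl
  ... | inj₂ (m , km , m∉I , dm) =
    trans (or-allFin⁺ (λ m → adj G k m ∧ y (inj₂ m)) m (∧-true⁺ km (trans (y∈ (inj₂ m) m∉I) dm)))
          (sym (delta-neighbour⇒notch km dm))

  shielded⇒trapSpace : ∀ I → Shielded I → IsTrapSpace (deltaNotch G) x (doubled I)
  shielded⇒trapSpace I shielded =
    frozen⇒trapSpace (deltaNotch G) x (doubled I) (shielded⇒frozen I shielded)

  dominatedOnlyBy : VSet L → VSet L
  dominatedOnlyBy W j =
    not (delta j) ∧ not (or (map (λ m → adj G j m ∧ (delta m ∧ not (W m))) (allFin L)))

  dominatedOnlyBy⁺ : ∀ {W j} → delta j ≡ false →
    (∀ m → adj G j m ≡ true → delta m ≡ true → W m ≡ true) → dominatedOnlyBy W j ≡ true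
  dominatedOnlyBy⁺ {W} {j} dj inW rewrite dj = cong not (or-false _ (allFin L) outside)
    where
    outside : ∀ m → (adj G j m ∧ (delta m ∧ not (W m))) ≡ false
    outside m with adj G j m in jm | delta m in dm
    ... | true | true rewrite inW m jm dm = refl
    ... | true | false = refl
    ... | false | _ = refl

  dominatedOnlyBy-delta : ∀ {W j} → delta j ≡ true → dominatedOnlyBy W j ≡ false
  dominatedOnlyBy-delta dj rewrite dj = refl

  dominatedOnlyBy-escape : ∀ {W j m} → adj G j m ≡ true → delta m ≡ true → W m ≡ false →
    dominatedOnlyBy W j ≡ false
  dominatedOnlyBy-escape {W} {j} {m} jm dm Wm
    rewrite or-allFin⁺ (λ m → adj G j m ∧ (delta m ∧ not (W m))) m
              (∧-true⁺ jm (∧-true⁺ dm (cong not Wm)))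
    = ∧-zeroʳ (not (delta j))

  dominatedOnlyBy⁻ : ∀ {W j} → dominatedOnlyBy W j ≡ true → ∃[ m ] adj G j m ≡ true × W m ≡ true
  dominatedOnlyBy⁻ {W} {j} Dj
    with notch-true⇒delta-neighbour (delta-false⇒notch (not-true⁻ (∧-conicalˡ _ _ Dj)))
  ... | m , jm , dm with W m in Wm
  ...   | true = m , jm , Wm
  ...   | false with trans (sym Dj) (dominatedOnlyBy-escape jm dm Wm)
  ...     | ()

  ∪-dominatedOnlyBy-shielded : ∀ {W} → W ⊆ delta → Shielded (W ∪ dominatedOnlyBy W)
  ∪-dominatedOnlyBy-shielded {W} W⊆delta k k∉I with delta k in dk
  ... | true = inj₁ λ m km →
    ∨-false⁺ (notInW m km) (dominatedOnlyBy-escape (trans (symmetric G m k) km) dk Wk)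
    where
    Wk : W k ≡ false
    Wk = ∨-conicalˡ _ _ k∉I
    notInW : ∀ m → adj G k m ≡ true → W m ≡ false
    notInW m km with W m in Wm
    ... | false = refl
    ... | true with trans (sym (delta-true⇒notch dk)) (delta-neighbour⇒notch km (W⊆delta m Wm))
    ...   | ()
  ... | false
    with or-allFin⁻ (λ m → adj G k m ∧ (delta m ∧ not (W m))) (not-false⁻ (∨-conicalʳ _ _ k∉I))
  ...   | m , outside =
    inj₂ (m , km , ∨-false⁺ (not-true⁻ (∧-conicalʳ _ _ rest)) (dominatedOnlyBy-delta dm) , dm)
    where
    km : adj G k m ≡ true
    km = ∧-conicalˡ (adj G k m) _ outside
    rest : (delta m ∧ not (W m)) ≡ true
    rest = ∧-conicalʳ (adj G k m) _ outside
    dm : delta m ≡ true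
    dm = ∧-conicalˡ _ _ rest

  ∪-dominatedOnlyBy-trapSpace : ∀ {W} → W ⊆ delta →
    IsTrapSpace (deltaNotch G) x (doubled (W ∪ dominatedOnlyBy W))
  ∪-dominatedOnlyBy-trapSpace W⊆delta = shielded⇒trapSpace _ (∪-dominatedOnlyBy-shielded W⊆delta)

  TrapSpaceAround : Fin L → VSet L → Set
  TrapSpaceAround i N =
    Σ (VSet L) λ I → (singleton i ⊆ I) × (I ⊆ N) × IsTrapSpace (deltaNotch G) x (doubled I)

  trapSpaceAround-closedNbhd : ∀ i → notch i ≡ false → TrapSpaceAround i (closedNbhd G i)
  trapSpaceAround-closedNbhd i ni =
    W ∪ dominatedOnlyBy W , ∪-introˡ ,
    ∪-least ∪-introˡ (⊆-trans dominated⊆adj (∪-introʳ {A = W})) ,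
    ∪-dominatedOnlyBy-trapSpace W⊆delta
    where
    W : VSet L
    W = singleton i
    W⊆delta : W ⊆ delta
    W⊆delta j ij with does-≟-sound {i = i} {j} ij
    ... | refl = notch-false⇒delta ni
    dominated⊆adj : dominatedOnlyBy W ⊆ adj G i
    dominated⊆adj j Dj with dominatedOnlyBy⁻ Dj
    ... | m , jm , im with does-≟-sound {i = i} {m} im
    ...   | refl = trans (symmetric G i j) jm

  trapSpaceAround-closedNbhd2 : ∀ i → notch i ≡ true → TrapSpaceAround i (closedNbhd2 G i)
  trapSpaceAround-closedNbhd2 i ni =
    W ∪ dominatedOnlyBy W , i∈I ,
    ∪-least (⊆-trans W⊆adj (⊆-trans (∪-introʳ {A = singleton i}) ∪-introˡ))
            (⊆-trans dominated⊆second (∪-introʳ {A = closedNbhd G i})) ,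
    ∪-dominatedOnlyBy-trapSpace W⊆delta
    where
    W : VSet L
    W = adj G i ∩ delta
    W⊆adj : W ⊆ adj G i
    W⊆adj m = ∧-conicalˡ (adj G i m) _
    W⊆delta : W ⊆ delta
    W⊆delta m = ∧-conicalʳ (adj G i m) _
    i∈I : singleton i ⊆ (W ∪ dominatedOnlyBy W)
    i∈I j ij with does-≟-sound {i = i} {j} ij
    ... | refl = ∪-introʳ {A = W} {dominatedOnlyBy W} i
                   (dominatedOnlyBy⁺ (trans (delta≡not-notch i) (cong not ni)) λ _ → ∧-true⁺)
    dominated⊆second : dominatedOnlyBy W ⊆ secondNbhd G i
    dominated⊆second j Dj with dominatedOnlyBy⁻ Dj
    ... | m , jm , Wm =
      or-allFin⁺ (λ k → adj G i k ∧ adj G k j) m (∧-true⁺ (W⊆adj m Wm) (trans (symmetric G m j) jm))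

proposition10 : (L : ℕ) → L ≥ 1 → (G : Graph L) → Connected G →
    (x : State L) → IsFixedPoint G x → (i : Fin L) →
    (x (inj₁ i) ≡ false →
      Σ (VSet L) λ I → (singleton i ⊆ I) × (I ⊆ closedNbhd G i)
        × IsTrapSpace (deltaNotch G) x (doubled I))
    × (x (inj₁ i) ≡ true →
      Σ (VSet L) λ I → (singleton i ⊆ I) × (I ⊆ closedNbhd2 G i)
        × IsTrapSpace (deltaNotch G) x (doubled I))
proposition10 L _ G _ x fp i = trapSpaceAround-closedNbhd i , trapSpaceAround-closedNbhd2 i
  where open FixedPoint G x fp
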